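{- Let $\mathcal{G}$ be a connected RCOP block graph, and let $\{u_1,v_1\}$ and $\{u_2,v_2\}$ be two edges of the same color contained in maximal cliques $\mathcal{C}_1$ and $\mathcal{C}_2$, respectively. Then for every $\gamma\in\Gamma(\mathcal{G})$ with $\gamma(\{u_1,v_1\})=\{u_2,v_2\}$ we have $\gamma(\mathcal{C}_1)=\mathcal{C}_2$. In particular, any two maximal cliques of $\mathcal{G}$ that share an edge color are isomorphic.
   Context: A colored graph $\mathcal{G}$ is a finite simple undirected graph on vertex set $[n]$ with a coloring $\lambda$ of its vertices and edges; $\Gamma(\mathcal{G})$ is the group of graph automorphisms preserving all vertex and edge colors. $\mathcal{G}$ is RCOP if the vertex colors and edge colors form disjoint sets, any two same-colored vertices are mapped to one another by some element of $\Gamma(\mathcal{G})$, and any two same-colored edges are mapped to one another by some element of $\Gamma(\mathcal{G})$. A graph on $[n]$ is a block graph if there is a vertex $c$ and a partition of $[n]$ into disjoint sets $A,B,\{c\}$ such that every path from $A$ to $B$ contains $c$, and the induced subgraphs on $A\cup\{c\}$ and $B\cup\{c\}$ are each complete graphs or block graphs. -}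

module Defs where

open import Data.Nat using (ℕ)
open import Data.Bool using (Bool; true; false)
open import Data.Fin using (Fin)
open import Data.Fin.Subset using (Subset; _∈_; _∉_; _⊆_; ⊤; ⁅_⁆; _∪_)
open import Data.List using (List; []; _∷_)
open import Data.List.Membership.Propositional using () renaming (_∈_ to _∈ₗ_)
open import Data.List.Relation.Unary.Unique.Propositional using (Unique)
open import Data.Product using (Σ; ∃; _×_; _,_)
open import Data.Sum using (_⊎_)
open import Data.Empty using (⊥)
open import Relation.Nullary using (¬_)
open import Relation.Binary.PropositionalEquality using (_≡_; _≢_)
open import Function.Bundles using (_↔_; Inverse)

-- Colours are natural numbers; vertex and edge colours live in the same
-- colour set, so "vertex colours and edge colours disjoint" is a real condition.
record ColoredGraph (n : ℕ) : Set where
  field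
    adj      : Fin n → Fin n → Bool
    adj-sym  : ∀ i j → adj i j ≡ adj j i
    adj-irr  : ∀ i → adj i i ≡ false
    vcol     : Fin n → ℕ
    -- colour of the edge {i,j} (only meaningful when adj i j ≡ true)
    ecol     : Fin n → Fin n → ℕ
    ecol-sym : ∀ i j → ecol i j ≡ ecol j i

module _ {n : ℕ} (G : ColoredGraph n) where
  open ColoredGraph G

  Edge : Fin n → Fin n → Set
  Edge i j = adj i j ≡ true

  IsAut : (Fin n ↔ Fin n) → Set
  IsAut γ =
    (∀ i j → adj (to i) (to j) ≡ adj i j) ×
    (∀ i → vcol (to i) ≡ vcol i) ×
    (∀ i j → Edge i j → ecol (to i) (to j) ≡ ecol i j)
    where open Inverse γ

  MapsEdge : (Fin n → Fin n) → Fin n → Fin n → Fin n → Fin n → Set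
  MapsEdge f a b c d = (f a ≡ c × f b ≡ d) ⊎ (f a ≡ d × f b ≡ c)

  RCOP : Set
  RCOP =
    (∀ v a b → Edge a b → vcol v ≢ ecol a b) ×
    (∀ u v → vcol u ≡ vcol v → Σ (Fin n ↔ Fin n) λ γ → IsAut γ × Inverse.to γ u ≡ v) ×
    (∀ a b c d → Edge a b → Edge c d → ecol a b ≡ ecol c d →
       Σ (Fin n ↔ Fin n) λ γ → IsAut γ × MapsEdge (Inverse.to γ) a b c d)

  data WalkIn (S : Subset n) : Fin n → Fin n → List (Fin n) → Set where
    here : ∀ {x} → x ∈ S → WalkIn S x x (x ∷ [])
    step : ∀ {x y z vs} → x ∈ S → Edge x y → WalkIn S y z vs → WalkIn S x z (x ∷ vs)

  PathIn : Subset n → Fin n → Fin n → List (Fin n) → Set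
  PathIn S x y vs = WalkIn S x y vs × Unique vs

  Connected : Set
  Connected = ∀ x y → ∃ λ vs → PathIn ⊤ x y vs

  CompleteOn : Subset n → Set
  CompleteOn S = ∀ x y → x ∈ S → y ∈ S → x ≢ y → Edge x y

  data BlockOn (S : Subset n) : Set where
    block : (c : Fin n) (A B : Subset n) →
      (∀ v → v ∈ S → v ∈ A ⊎ v ∈ B ⊎ v ≡ c) →
      A ⊆ S → B ⊆ S → c ∈ S →
      (∀ v → v ∈ A → v ∉ B) → c ∉ A → c ∉ B →
      (∀ a b vs → a ∈ A → b ∈ B → PathIn S a b vs → c ∈ₗ vs) →
      (CompleteOn (A ∪ ⁅ c ⁆) ⊎ BlockOn (A ∪ ⁅ c ⁆)) →
      (CompleteOn (B ∪ ⁅ c ⁆) ⊎ BlockOn (B ∪ ⁅ c ⁆)) →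
      BlockOn S

  BlockGraph : Set
  BlockGraph = BlockOn ⊤

  IsClique : Subset n → Set
  IsClique = CompleteOn

  MaximalClique : Subset n → Set
  MaximalClique K = IsClique K × (∀ K' → IsClique K' → K ⊆ K' → K' ⊆ K)

  MapsSet : (Fin n → Fin n) → Subset n → Subset n → Set
  MapsSet f C₁ C₂ = (∀ v → v ∈ C₁ → f v ∈ C₂) × (∀ w → w ∈ C₂ → ∃ λ v → v ∈ C₁ × f v ≡ w)

  IsoInduced : Subset n → Subset n → Set
  IsoInduced C₁ C₂ = Σ (Fin n → Fin n) λ f →
    MapsSet f C₁ C₂ ×
    (∀ x y → x ∈ C₁ → y ∈ C₁ → f x ≡ f y → x ≡ y) ×
    (∀ x y → x ∈ C₁ → y ∈ C₁ → adj (f x) (f y) ≡ adj x y) ×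
    (∀ x → x ∈ C₁ → vcol (f x) ≡ vcol x) ×
    (∀ x y → x ∈ C₁ → y ∈ C₁ → Edge x y → ecol (f x) (f y) ≡ ecol x y)

module Submission where

open import Defs
open import Data.Nat using (ℕ)
open import Data.Bool using (true)
import Data.Bool as Bool
open import Data.Fin using (Fin; _≟_)
open import Data.Fin.Subset using (Subset; _∈_; _∉_; ⊤; ⁅_⁆; _∪_)
open import Data.Fin.Subset.Properties
  using (_∈?_; ∈⊤; x∈⁅x⁆; x∈⁅y⁆⇒x≡y; x∈p∪q⁺; x∈p∪q⁻)
open import Data.Fin.Properties using (any?)
open import Data.List using ([]; _∷_)
open import Data.List.Membership.Propositional using () renaming (_∈_ to _∈ₗ_)
open import Data.List.Relation.Unary.Any using (here; there)
open import Data.List.Relation.Unary.All using ([]; _∷_)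
open import Data.List.Relation.Unary.AllPairs using ([]; _∷_)
open import Data.List.Relation.Unary.Unique.Propositional using (Unique)
open import Data.Product using (_×_; _,_; proj₁)
open import Data.Sum using (_⊎_; inj₁; inj₂)
open import Data.Empty using (⊥-elim)
open import Relation.Nullary using (¬_; yes; no)
open import Relation.Nullary.Decidable using (_×-dec_; ¬?)
open import Relation.Binary.PropositionalEquality
  using (_≡_; _≢_; refl; sym; trans; cong₂; subst)
open import Function.Bundles using (_↔_; Inverse; Injection)
open import Function.Properties.Inverse using (↔⇒↣)

-- Block graphs are diamond-free: a diamond is 2-connected, so it cannot straddle a
-- cut vertex and must live inside one side of the decomposition, hence inside a
-- clique, where p and q would be adjacent.  In a diamond-free graph, a vertex
-- adjacent to both ends of an edge of a maximal clique C lies in C: otherwise it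
-- is adjacent to all of C (a non-neighbour in C would close a diamond) and C is
-- not maximal.  An automorphism γ maps every other vertex of C₁ to a common
-- neighbour of the edge γ{u₁,v₁} = {u₂,v₂}, so γ(C₁) ⊆ C₂, and γ⁻¹(C₂) ⊆ C₁ likewise.

module _ {n : ℕ} (G : ColoredGraph n) where
  open ColoredGraph G

  edge⇒≢ : ∀ {x y} → Edge G x y → x ≢ y
  edge⇒≢ {x} e refl with trans (sym e) (adj-irr x)
  ... | ()

  edge-sym : ∀ {x y} → Edge G x y → Edge G y x
  edge-sym {x} {y} e = trans (adj-sym y x) e

  record IsDiamond (p q a b : Fin n) : Set where
    field
      p~a : Edge G p a
      p~b : Edge G p b
      q~a : Edge G q a
      q~b : Edge G q b
      a~b : Edge G a b
      p≢q : p ≢ q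
      p≁q : ¬ Edge G p q

  diamond-swap : ∀ {p q a b} → IsDiamond p q a b → IsDiamond p q b a
  diamond-swap d = record
    { p~a = p~b ; p~b = p~a ; q~a = q~b ; q~b = q~a ; a~b = edge-sym a~b
    ; p≢q = p≢q ; p≁q = p≁q }
    where open IsDiamond d

  DiamondFree : Subset n → Set
  DiamondFree S = ∀ {p q a b} → p ∈ S → q ∈ S → a ∈ S → b ∈ S → ¬ IsDiamond p q a b

  completeOn⇒diamondFree : ∀ {S} → CompleteOn G S → DiamondFree S
  completeOn⇒diamondFree K pS qS _ _ d = p≁q (K _ _ pS qS p≢q)
    where open IsDiamond d

  diamondFree-closedNbhd : ∀ {S X a} → DiamondFree X → a ∈ X →
    (∀ {v} → v ∈ S → Edge G a v → v ∈ X) →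
    ∀ {p q b} → p ∈ S → q ∈ S → b ∈ S → ¬ IsDiamond p q a b
  diamondFree-closedNbhd free aX closed pS qS bS d =
    free (closed pS (edge-sym p~a)) (closed qS (edge-sym q~a)) aX (closed bS a~b) d
    where open IsDiamond d

  separator⇒noEdge : ∀ {S c A B} →
    (∀ v → v ∈ A → v ∉ B) → c ∉ A → c ∉ B →
    (∀ a b vs → a ∈ A → b ∈ B → PathIn G S a b vs → c ∈ₗ vs) →
    ∀ {a b} → a ∈ A → b ∈ B → a ∈ S → b ∈ S → ¬ Edge G a b
  separator⇒noEdge {A = A} {B} disjoint c∉A c∉B separates {a} {b} aA bB aS bS e
    with separates a b (a ∷ b ∷ []) aA bB (step aS e (here bS) , unique)
    where
    unique : Unique (a ∷ b ∷ [])
    unique = ((λ a≡b → disjoint a aA (subst (_∈ B) (sym a≡b) bB)) ∷ []) ∷ [] ∷ []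
  ... | here refl         = c∉A aA
  ... | there (here refl) = c∉B bB

  mutual
    completeOrBlock⇒diamondFree : ∀ {S} → CompleteOn G S ⊎ BlockOn G S → DiamondFree S
    completeOrBlock⇒diamondFree (inj₁ K) = completeOn⇒diamondFree K
    completeOrBlock⇒diamondFree (inj₂ β) = blockOn⇒diamondFree β

    blockOn⇒diamondFree : ∀ {S} → BlockOn G S → DiamondFree S
    blockOn⇒diamondFree {S} (block c A B part A⊆S B⊆S _ disjoint c∉A c∉B separates L R) = free
      where
      noEdge : ∀ {x y} → x ∈ A → y ∈ B → ¬ Edge G x y
      noEdge xA yB = separator⇒noEdge disjoint c∉A c∉B separates xA yB (A⊆S xA) (B⊆S yB)

      nbhdA : ∀ {x v} → x ∈ A → v ∈ S → Edge G x v → v ∈ A ∪ ⁅ c ⁆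
      nbhdA {v = v} xA vS e with part v vS
      ... | inj₁ vA          = x∈p∪q⁺ (inj₁ vA)
      ... | inj₂ (inj₁ vB)   = ⊥-elim (noEdge xA vB e)
      ... | inj₂ (inj₂ refl) = x∈p∪q⁺ (inj₂ (x∈⁅x⁆ c))

      nbhdB : ∀ {x v} → x ∈ B → v ∈ S → Edge G x v → v ∈ B ∪ ⁅ c ⁆
      nbhdB {v = v} xB vS e with part v vS
      ... | inj₁ vA          = ⊥-elim (noEdge vA xB (edge-sym e))
      ... | inj₂ (inj₁ vB)   = x∈p∪q⁺ (inj₁ vB)
      ... | inj₂ (inj₂ refl) = x∈p∪q⁺ (inj₂ (x∈⁅x⁆ c))

      onA : ∀ {x} → x ∈ A → ∀ {p q y} → p ∈ S → q ∈ S → y ∈ S → ¬ IsDiamond p q x y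
      onA xA = diamondFree-closedNbhd (completeOrBlock⇒diamondFree L)
                 (x∈p∪q⁺ (inj₁ xA)) (nbhdA xA)

      onB : ∀ {x} → x ∈ B → ∀ {p q y} → p ∈ S → q ∈ S → y ∈ S → ¬ IsDiamond p q x y
      onB xB = diamondFree-closedNbhd (completeOrBlock⇒diamondFree R)
                 (x∈p∪q⁺ (inj₁ xB)) (nbhdB xB)

      -- An edge ab has an end different from the cut vertex c; the diamond lives on its side.
      free : DiamondFree S
      free {a = a} {b} pS qS aS bS d with part a aS | part b bS
      ... | inj₁ aA          | _                = onA aA pS qS bS d
      ... | inj₂ (inj₁ aB)   | _                = onB aB pS qS bS d
      ... | inj₂ (inj₂ refl) | inj₁ bA          = onA bA pS qS aS (diamond-swap d)
      ... | inj₂ (inj₂ refl) | inj₂ (inj₁ bB)   = onB bB pS qS aS (diamond-swap d)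
      ... | inj₂ (inj₂ refl) | inj₂ (inj₂ refl) = edge⇒≢ (IsDiamond.a~b d) refl

  completeOn-∪⁅⁆ : ∀ {C p} → CompleteOn G C →
    (∀ z → z ∈ C → z ≢ p → Edge G p z) → CompleteOn G (C ∪ ⁅ p ⁆)
  completeOn-∪⁅⁆ {C} {p} K adjP x y xK yK x≢y
    with x∈p∪q⁻ C ⁅ p ⁆ xK | x∈p∪q⁻ C ⁅ p ⁆ yK
  ... | inj₁ xC | inj₁ yC = K x y xC yC x≢y
  ... | inj₁ xC | inj₂ yp rewrite x∈⁅y⁆⇒x≡y p yp = edge-sym (adjP x xC x≢y)
  ... | inj₂ xp | inj₁ yC rewrite x∈⁅y⁆⇒x≡y p xp = adjP y yC (λ y≡p → x≢y (sym y≡p))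
  ... | inj₂ xp | inj₂ yp = ⊥-elim (x≢y (trans (x∈⁅y⁆⇒x≡y p xp) (sym (x∈⁅y⁆⇒x≡y p yp))))

  commonNeighbour∈maximalClique : DiamondFree ⊤ → ∀ {C u v p} → MaximalClique G C →
    u ∈ C → v ∈ C → Edge G u v → Edge G p u → Edge G p v → p ∈ C
  commonNeighbour∈maximalClique free {C} {u} {v} {p} (K , maximal) uC vC u~v p~u p~v
    with any? (λ y → (y ∈? C) ×-dec ¬? (y ≟ p) ×-dec ¬? (adj p y Bool.≟ true))
  ... | yes (y , yC , y≢p , p≁y) = ⊥-elim (free ∈⊤ ∈⊤ ∈⊤ ∈⊤ diamond)
    where
    y~ : ∀ {w} → w ∈ C → Edge G p w → Edge G y w
    y~ {w} wC p~w = K y w yC wC (λ y≡w → p≁y (subst (Edge G p) (sym y≡w) p~w))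
    diamond : IsDiamond p y u v
    diamond = record
      { p~a = p~u ; p~b = p~v ; q~a = y~ uC p~u ; q~b = y~ vC p~v ; a~b = u~v
      ; p≢q = λ p≡y → y≢p (sym p≡y) ; p≁q = p≁y }
  ... | no noNonNeighbour = maximal (C ∪ ⁅ p ⁆) (completeOn-∪⁅⁆ K adjacentToAll)
                              (λ z → x∈p∪q⁺ (inj₁ z)) (x∈p∪q⁺ (inj₂ (x∈⁅x⁆ p)))
    where
    adjacentToAll : ∀ z → z ∈ C → z ≢ p → Edge G p z
    adjacentToAll z zC z≢p with adj p z Bool.≟ true
    ... | yes p~z = p~z
    ... | no p≁z  = ⊥-elim (noNonNeighbour (z , zC , z≢p , p≁z))

  homomorphism-clique⊆maximalClique : DiamondFree ⊤ → (f : Fin n → Fin n) →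
    (∀ {x y} → Edge G x y → Edge G (f x) (f y)) →
    ∀ {C₁ C₂ u v} → CompleteOn G C₁ → MaximalClique G C₂ →
    u ∈ C₁ → v ∈ C₁ → f u ∈ C₂ → f v ∈ C₂ → Edge G (f u) (f v) →
    ∀ x → x ∈ C₁ → f x ∈ C₂
  homomorphism-clique⊆maximalClique free f hom {C₁} {C₂} {u} {v} K₁ M₂ uC vC fuC fvC fu~fv x xC
    with x ≟ u | x ≟ v
  ... | yes refl | _        = fuC
  ... | no _     | yes refl = fvC
  ... | no x≢u   | no x≢v   =
    commonNeighbour∈maximalClique free M₂ fuC fvC fu~fv
      (hom (K₁ x u xC uC x≢u)) (hom (K₁ x v xC vC x≢v))

  preservesAdj⇒preservesEdge : (f : Fin n → Fin n) → (∀ i j → adj (f i) (f j) ≡ adj i j) →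
    ∀ {x y} → Edge G x y → Edge G (f x) (f y)
  preservesAdj⇒preservesEdge f pres {x} {y} e = trans (pres x y) e

  inverse-preservesAdj : (γ : Fin n ↔ Fin n) →
    (∀ i j → adj (Inverse.to γ i) (Inverse.to γ j) ≡ adj i j) →
    ∀ i j → adj (Inverse.from γ i) (Inverse.from γ j) ≡ adj i j
  inverse-preservesAdj γ pres i j =
    trans (sym (pres (from i) (from j))) (cong₂ adj (strictlyInverseˡ i) (strictlyInverseˡ j))
    where open Inverse γ

  mapsEdge-inverse : (γ : Fin n ↔ Fin n) → ∀ {a b c d} →
    MapsEdge G (Inverse.to γ) a b c d → MapsEdge G (Inverse.from γ) c d a b
  mapsEdge-inverse γ (inj₁ (refl , refl)) = inj₁ (strictlyInverseʳ _ , strictlyInverseʳ _)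
    where open Inverse γ
  mapsEdge-inverse γ (inj₂ (refl , refl)) = inj₂ (strictlyInverseʳ _ , strictlyInverseʳ _)
    where open Inverse γ

  homomorphism-mapsClique : DiamondFree ⊤ → (f : Fin n → Fin n) →
    (∀ {x y} → Edge G x y → Edge G (f x) (f y)) →
    ∀ {C₁ C₂ u₁ v₁ u₂ v₂} → CompleteOn G C₁ → MaximalClique G C₂ →
    u₁ ∈ C₁ → v₁ ∈ C₁ → u₂ ∈ C₂ → v₂ ∈ C₂ → Edge G u₂ v₂ →
    MapsEdge G f u₁ v₁ u₂ v₂ → ∀ x → x ∈ C₁ → f x ∈ C₂
  homomorphism-mapsClique free f hom K₁ M₂ u₁C v₁C u₂C v₂C e (inj₁ (refl , refl)) =
    homomorphism-clique⊆maximalClique free f hom K₁ M₂ u₁C v₁C u₂C v₂C e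
  homomorphism-mapsClique free f hom K₁ M₂ u₁C v₁C u₂C v₂C e (inj₂ (refl , refl)) =
    homomorphism-clique⊆maximalClique free f hom K₁ M₂ v₁C u₁C u₂C v₂C e

  automorphism-mapsMaximalClique : DiamondFree ⊤ → (γ : Fin n ↔ Fin n) →
    (∀ i j → adj (Inverse.to γ i) (Inverse.to γ j) ≡ adj i j) →
    ∀ {C₁ C₂ u₁ v₁ u₂ v₂} → MaximalClique G C₁ → MaximalClique G C₂ →
    u₁ ∈ C₁ → v₁ ∈ C₁ → u₂ ∈ C₂ → v₂ ∈ C₂ → Edge G u₁ v₁ → Edge G u₂ v₂ →
    MapsEdge G (Inverse.to γ) u₁ v₁ u₂ v₂ → MapsSet G (Inverse.to γ) C₁ C₂
  automorphism-mapsMaximalClique free γ pres M₁ M₂ u₁C v₁C u₂C v₂C e₁ e₂ me =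
    homomorphism-mapsClique free to (preservesAdj⇒preservesEdge to pres)
      (proj₁ M₁) M₂ u₁C v₁C u₂C v₂C e₂ me ,
    λ w wC → from w ,
      homomorphism-mapsClique free from
        (preservesAdj⇒preservesEdge from (inverse-preservesAdj γ pres))
        (proj₁ M₂) M₁ u₂C v₂C u₁C v₁C e₁ (mapsEdge-inverse γ me) w wC ,
      strictlyInverseˡ w
    where open Inverse γ

  automorphism-isoInduced : (γ : Fin n ↔ Fin n) → IsAut G γ →
    ∀ {C₁ C₂} → MapsSet G (Inverse.to γ) C₁ C₂ → IsoInduced G C₁ C₂
  automorphism-isoInduced γ (presAdj , presVcol , presEcol) γC₁≡C₂ =
    Inverse.to γ ,
    γC₁≡C₂ ,
    (λ _ _ _ _ → Injection.injective (↔⇒↣ γ)) ,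
    (λ x y _ _ → presAdj x y) ,
    (λ x _ → presVcol x) ,
    (λ x y _ _ → presEcol x y)

  edgeColour-isoInduced : DiamondFree ⊤ → RCOP G →
    ∀ {C₁ C₂ u₁ v₁ u₂ v₂} → MaximalClique G C₁ → MaximalClique G C₂ →
    u₁ ∈ C₁ → v₁ ∈ C₁ → u₂ ∈ C₂ → v₂ ∈ C₂ → Edge G u₁ v₁ → Edge G u₂ v₂ →
    ecol u₁ v₁ ≡ ecol u₂ v₂ → IsoInduced G C₁ C₂
  edgeColour-isoInduced free (_ , _ , edgeTransitive) M₁ M₂ u₁C v₁C u₂C v₂C e₁ e₂ sameColour
    with edgeTransitive _ _ _ _ e₁ e₂ sameColour
  ... | γ , aut , me = automorphism-isoInduced γ aut
    (automorphism-mapsMaximalClique free γ (proj₁ aut) M₁ M₂ u₁C v₁C u₂C v₂C e₁ e₂ me)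

lemma4p9 : {n : ℕ} (G : ColoredGraph n) →
    Connected G → RCOP G → BlockGraph G →
    (∀ (u₁ v₁ u₂ v₂ : Fin n) (C₁ C₂ : Subset n) →
      Edge G u₁ v₁ → Edge G u₂ v₂ →
      ColoredGraph.ecol G u₁ v₁ ≡ ColoredGraph.ecol G u₂ v₂ →
      MaximalClique G C₁ → MaximalClique G C₂ →
      u₁ ∈ C₁ → v₁ ∈ C₁ → u₂ ∈ C₂ → v₂ ∈ C₂ →
      (γ : Fin n ↔ Fin n) → IsAut G γ →
      MapsEdge G (Inverse.to γ) u₁ v₁ u₂ v₂ →
      MapsSet G (Inverse.to γ) C₁ C₂)
    ×
    (∀ (C₁ C₂ : Subset n) (u₁ v₁ u₂ v₂ : Fin n) →
      MaximalClique G C₁ → MaximalClique G C₂ →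
      u₁ ∈ C₁ → v₁ ∈ C₁ → u₂ ∈ C₂ → v₂ ∈ C₂ →
      Edge G u₁ v₁ → Edge G u₂ v₂ →
      ColoredGraph.ecol G u₁ v₁ ≡ ColoredGraph.ecol G u₂ v₂ →
      IsoInduced G C₁ C₂)
lemma4p9 G _ rcop blockGraph =
  (λ _ _ _ _ _ _ e₁ e₂ _ M₁ M₂ u₁C v₁C u₂C v₂C γ aut →
    automorphism-mapsMaximalClique G free γ (proj₁ aut) M₁ M₂ u₁C v₁C u₂C v₂C e₁ e₂) ,
  (λ _ _ _ _ _ _ M₁ M₂ u₁C v₁C u₂C v₂C e₁ e₂ →
    edgeColour-isoInduced G free rcop M₁ M₂ u₁C v₁C u₂C v₂C e₁ e₂)
  where
  free : DiamondFree G ⊤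
  free = blockOn⇒diamondFree G blockGraph
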